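{- Let $q\geq 2$ and let $C$ be a completely regular code in $H(3,q)$ with covering radius $1$ such that $C=C^1\cup C^2\cup C^3$, where for each $i\in\{1,2,3\}$, $C^i$ is a nonempty union of maximum cliques of codirection $i$, and $C^1,C^2,C^3$ are pairwise disjoint. Let $S,T,R,T',R',S'\subseteq\mathcal{A}$ be the minimal (by inclusion) sets such that $C^1\subseteq\mathcal{A}\times S\times T$, $C^2\subseteq R\times\mathcal{A}\times T'$, and $C^3\subseteq R'\times S'\times\mathcal{A}$. Then $R'=\mathcal{A}\setminus R$, $T'=\mathcal{A}\setminus T$, and $S'=\mathcal{A}\setminus S$.
   Context: Let $\mathcal{A}$ be a set of size $q$; $H(3,q)$ has vertex set $\mathcal{A}^3$, tuples adjacent iff they differ in exactly one position. A set $C$ of vertices is a completely regular code with covering radius $1$ if $C$ is a nonempty proper subset and there are integers $\beta,\gamma\geq1$ such that every vertex of $C$ has exactly $\beta$ neighbours outside $C$ and every vertex outside $C$ has exactly $\gamma$ neighbours in $C$. A maximum clique of codirection $i\in\{1,2,3\}$ is a set of $q$ tuples agreeing in all positions except position $i$ and taking all $q$ symbols in position $i$. -}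

module Defs where

open import Data.Nat using (ℕ; _+_)
open import Data.Fin using (Fin; _≟_)
open import Data.List using (List; map; allFin)
open import Data.Nat.ListAction using (sum)
open import Data.Bool using (Bool; true; false; _∧_; _∨_; not; if_then_else_)
open import Data.Product using (_×_; _,_)
open import Relation.Nullary using (does)
open import Relation.Binary.PropositionalEquality using (_≡_)
open import Data.Empty using (⊥)

-- Alphabet 𝒜 = Fin q.  Vertices of H(3,q) are triples.
Vertex : ℕ → Set
Vertex q = Fin q × Fin q × Fin q

VSet : ℕ → Set
VSet q = Vertex q → Bool

ASet : ℕ → Set
ASet q = Fin q → Bool

Σ[_]_ : (q : ℕ) → (Fin q → ℕ) → ℕ
Σ[ q ] f = sum (map f (allFin q))

bit : Bool → ℕ
bit true = 1
bit false = 0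

neq : ∀ {q} → Fin q → Fin q → ℕ
neq a b = bit (not (does (a ≟ b)))

dist : ∀ {q} → Vertex q → Vertex q → ℕ
dist (x , y , z) (x' , y' , z') = neq x x' + neq y y' + neq z z'

adj : ∀ {q} → Vertex q → Vertex q → Bool
adj u v with dist u v
... | 1 = true
... | _ = false

nbrsIn : ∀ {q} → VSet q → Vertex q → ℕ
nbrsIn {q} P v = Σ[ q ] λ x → Σ[ q ] λ y → Σ[ q ] λ z →
  bit (adj v (x , y , z) ∧ P (x , y , z))

_∈_ : ∀ {q} → Vertex q → VSet q → Set
v ∈ P = P v ≡ true

_∉_ : ∀ {q} → Vertex q → VSet q → Set
v ∉ P = P v ≡ false

CompletelyRegular1 : ∀ {q} → VSet q → Set
CompletelyRegular1 {q} C =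
  (∃v (λ v → v ∈ C)) × (∃v (λ v → v ∉ C)) ×
  Σℕ λ β → Σℕ λ γ → (1 ≤ β) × (1 ≤ γ) ×
    (∀ v → v ∈ C → nbrsIn (λ w → not (C w)) v ≡ β) ×
    (∀ v → v ∉ C → nbrsIn C v ≡ γ)
  where
  open import Data.Product using (Σ)
  open import Data.Nat using (_≤_)
  ∃v : (Vertex q → Set) → Set
  ∃v P = Σ (Vertex q) P
  Σℕ : (ℕ → Set) → Set
  Σℕ P = Σ ℕ P

-- the maximum clique of codirection i through vertex v (varying coordinate i)
update : ∀ {q} → Fin 3 → Fin q → Vertex q → Vertex q
update Fin.zero a (x , y , z) = (a , y , z)
update (Fin.suc Fin.zero) a (x , y , z) = (x , a , z)
update (Fin.suc (Fin.suc Fin.zero)) a (x , y , z) = (x , y , a)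

UnionOfMaxCliques : ∀ {q} → Fin 3 → VSet q → Set
UnionOfMaxCliques {q} i D = ∀ v → v ∈ D → ∀ (a : Fin q) → update i a v ∈ D

Nonempty : ∀ {q} → VSet q → Set
Nonempty {q} D = Σ (Vertex q) (λ v → v ∈ D)
  where open import Data.Product using (Σ)

Disjoint : ∀ {q} → VSet q → VSet q → Set
Disjoint D E = ∀ v → v ∈ D → v ∈ E → ⊥

SubBox : ∀ {q} → VSet q → ASet q → ASet q → ASet q → Set
SubBox D X Y Z = ∀ x y z → (x , y , z) ∈ D → (X x ≡ true) × (Y y ≡ true) × (Z z ≡ true)

_⊆A_ : ∀ {q} → ASet q → ASet q → Set
X ⊆A Y = ∀ a → X a ≡ true → Y a ≡ true

MinimalBox : ∀ {q} → VSet q → ASet q → ASet q → ASet q → Set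
MinimalBox D X Y Z = SubBox D X Y Z ×
  (∀ X₀ Y₀ Z₀ → SubBox D X₀ Y₀ Z₀ → (X ⊆A X₀) × (Y ⊆A Y₀) × (Z ⊆A Z₀))

-- Suppose some layer c (third coordinate) met neither C¹ nor C², so that C is there
-- contained in C³. Take a C¹-vertex (a, b, z₁) and, in a C³-line, the vertices
-- v₀ = (x, y, c) and v₁ = (x, y, z₁). Swapping the symbols c and z₁ in the third
-- coordinate is an automorphism of H(3,q) mapping v₀ to v₁; it maps the C-neighbours
-- of v₀ into C, while the outer neighbour (x, b, c) of v₀ is mapped to the C¹-vertex
-- (x, b, z₁). So v₁ has fewer outer neighbours than v₀, contradicting complete
-- regularity; hence T ∪ T′ is everything. That T ∩ T′ = ∅ follows from minimality
-- alone: a C¹-line and a C²-line lying in one layer would meet. The other two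
-- coordinates are reduced to this one by cyclically rotating coordinates.
module Submission where

open import Defs
open import Data.Nat using (ℕ; zero; suc; _≤_; _<_; _+_; z≤n; s≤s)
open import Data.Nat.Properties
  using (+-mono-≤; +-mono-<-≤; +-mono-≤-<; +-comm; +-assoc; <-irrefl; +-cancelʳ-≡;
         m+n≡0⇒m≡0; m+n≡0⇒n≡0; +-0-commutativeMonoid; module ≤-Reasoning)
open import Data.Nat.ListAction using (sum)
open import Data.Fin using (Fin; zero; suc; _≟_)
open import Data.Fin.Permutation using (Permutation; _⟨$⟩ʳ_; _⟨$⟩ˡ_; inverseˡ; transpose)
import Data.Fin.Permutation.Components as PC
open import Data.Bool using (Bool; true; false; not; _∨_; _∧_)
open import Data.Bool.Properties using (∧-zeroʳ; ∨-zeroʳ; ¬-not)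
open import Data.Product using (_×_; _,_; proj₁; proj₂)
open import Data.Sum using (_⊎_; inj₁; inj₂; [_,_]′)
open import Data.List using ([]; _∷_; map; allFin; tabulate)
open import Data.List.Properties using (map-cong; map-tabulate)
open import Data.List.Membership.Propositional using () renaming (_∈_ to _∈ˡ_)
open import Data.List.Membership.Propositional.Properties using (∈-allFin)
open import Data.List.Relation.Unary.Any using (here; there)
open import Data.Empty using (⊥; ⊥-elim)
open import Function using (_∘_; id)
open import Relation.Nullary using (¬_; does; yes; no)
open import Relation.Nullary.Decidable using (dec-true; dec-false)
open import Relation.Binary.PropositionalEquality
import Algebra.Properties.CommutativeMonoid.Sum +-0-commutativeMonoid as ∑

true≢false : true ≢ false
true≢false ()

sum-map-mono-≤ : ∀ {A : Set} {f g : A → ℕ} → (∀ x → f x ≤ g x) →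
                 ∀ xs → sum (map f xs) ≤ sum (map g xs)
sum-map-mono-≤ f≤g []       = z≤n
sum-map-mono-≤ f≤g (x ∷ xs) = +-mono-≤ (f≤g x) (sum-map-mono-≤ f≤g xs)

sum-map-mono-< : ∀ {A : Set} {f g : A → ℕ} {x xs} → (∀ y → f y ≤ g y) →
                 x ∈ˡ xs → f x < g x → sum (map f xs) < sum (map g xs)
sum-map-mono-< {xs = _ ∷ xs} f≤g (here refl) fx<gx = +-mono-<-≤ fx<gx (sum-map-mono-≤ f≤g xs)
sum-map-mono-< f≤g (there x∈xs) fx<gx = +-mono-≤-< (f≤g _) (sum-map-mono-< f≤g x∈xs fx<gx)

Σ-cong : ∀ q {f g : Fin q → ℕ} → (∀ i → f i ≡ g i) → Σ[ q ] f ≡ Σ[ q ] g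
Σ-cong q f≗g = cong sum (map-cong f≗g (allFin q))

Σ-mono-≤ : ∀ q {f g : Fin q → ℕ} → (∀ i → f i ≤ g i) → Σ[ q ] f ≤ Σ[ q ] g
Σ-mono-≤ q f≤g = sum-map-mono-≤ f≤g (allFin q)

Σ-mono-< : ∀ q {f g : Fin q → ℕ} → (∀ i → f i ≤ g i) → ∀ i → f i < g i → Σ[ q ] f < Σ[ q ] g
Σ-mono-< q f≤g i = sum-map-mono-< f≤g (∈-allFin i)

sum-tabulate : ∀ q (f : Fin q → ℕ) → sum (tabulate f) ≡ ∑.sum f
sum-tabulate zero    f = refl
sum-tabulate (suc q) f = cong (f zero +_) (sum-tabulate q (f ∘ suc))

Σ≡∑ : ∀ q (f : Fin q → ℕ) → Σ[ q ] f ≡ ∑.sum f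
Σ≡∑ q f = trans (cong sum (map-tabulate id f)) (sum-tabulate q f)

Σ-swap : ∀ q (f : Fin q → Fin q → ℕ) →
         Σ[ q ] (λ i → Σ[ q ] (f i)) ≡ Σ[ q ] (λ j → Σ[ q ] (λ i → f i j))
Σ-swap q f = begin
  Σ[ q ] (λ i → Σ[ q ] (f i))             ≡⟨ Σ-cong q (λ i → Σ≡∑ q (f i)) ⟩
  Σ[ q ] (λ i → ∑.sum (f i))              ≡⟨ Σ≡∑ q _ ⟩
  ∑.sum (λ i → ∑.sum (f i))               ≡⟨ ∑.∑-comm f ⟩
  ∑.sum (λ j → ∑.sum (λ i → f i j))       ≡⟨ Σ≡∑ q _ ⟨
  Σ[ q ] (λ j → ∑.sum (λ i → f i j))      ≡⟨ Σ-cong q (λ j → Σ≡∑ q (λ i → f i j)) ⟨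
  Σ[ q ] (λ j → Σ[ q ] (λ i → f i j))     ∎
  where open ≡-Reasoning

Σ-permute : ∀ q (π : Permutation q q) (f : Fin q → ℕ) → Σ[ q ] (f ∘ (π ⟨$⟩ʳ_)) ≡ Σ[ q ] f
Σ-permute q π f = begin
  Σ[ q ] (f ∘ (π ⟨$⟩ʳ_))  ≡⟨ Σ≡∑ q _ ⟩
  ∑.sum (f ∘ (π ⟨$⟩ʳ_))   ≡⟨ ∑.sum-permute f π ⟨
  ∑.sum f                 ≡⟨ Σ≡∑ q f ⟨
  Σ[ q ] f                ∎
  where open ≡-Reasoning

ΣV : ∀ q → (Vertex q → ℕ) → ℕ
ΣV q h = Σ[ q ] λ x → Σ[ q ] λ y → Σ[ q ] λ z → h (x , y , z)

ΣV-cong : ∀ q {h k : Vertex q → ℕ} → (∀ w → h w ≡ k w) → ΣV q h ≡ ΣV q k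
ΣV-cong q h≗k = Σ-cong q λ x → Σ-cong q λ y → Σ-cong q λ z → h≗k (x , y , z)

ΣV-mono-< : ∀ q {h k : Vertex q → ℕ} → (∀ w → h w ≤ k w) → ∀ w → h w < k w → ΣV q h < ΣV q k
ΣV-mono-< q h≤k (x , y , z) hw<kw =
  Σ-mono-< q (λ x → Σ-mono-≤ q λ y → Σ-mono-≤ q λ z → h≤k _) x
    (Σ-mono-< q (λ y → Σ-mono-≤ q λ z → h≤k _) y
      (Σ-mono-< q (λ z → h≤k _) z hw<kw))

ρ : ∀ {q} → Vertex q → Vertex q
ρ (x , y , z) = (z , x , y)

ΣV-ρ : ∀ q (h : Vertex q → ℕ) → ΣV q (h ∘ ρ) ≡ ΣV q h
ΣV-ρ q h = trans (Σ-cong q λ x → Σ-swap q λ y z → h (z , x , y))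
                 (Σ-swap q λ x z → Σ[ q ] λ y → h (z , x , y))

relabel₃ : ∀ {q} → Permutation q q → Vertex q → Vertex q
relabel₃ π (x , y , z) = (x , y , π ⟨$⟩ʳ z)

ΣV-relabel₃ : ∀ q (π : Permutation q q) (h : Vertex q → ℕ) → ΣV q (h ∘ relabel₃ π) ≡ ΣV q h
ΣV-relabel₃ q π h = Σ-cong q λ x → Σ-cong q λ y → Σ-permute q π λ z → h (x , y , z)

neq-refl : ∀ {q} (a : Fin q) → neq a a ≡ 0
neq-refl a rewrite dec-true (a ≟ a) refl = refl

neq-≢ : ∀ {q} {a b : Fin q} → a ≢ b → neq a b ≡ 1
neq-≢ {a = a} {b} a≢b rewrite dec-false (a ≟ b) a≢b = refl

neq≡0⇒≡ : ∀ {q} (a b : Fin q) → neq a b ≡ 0 → a ≡ b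
neq≡0⇒≡ a b neq≡0 with a ≟ b
... | yes a≡b = a≡b

neq-permute : ∀ {q} (π : Permutation q q) (a b : Fin q) → neq (π ⟨$⟩ʳ a) (π ⟨$⟩ʳ b) ≡ neq a b
neq-permute π a b with a ≟ b
... | yes refl = neq-refl (π ⟨$⟩ʳ a)
... | no a≢b   = neq-≢ λ πa≡πb → a≢b (trans (sym (inverseˡ π)) (trans (cong (π ⟨$⟩ˡ_) πa≡πb) (inverseˡ π)))

isOne : ℕ → Bool
isOne 1 = true
isOne _ = false

adj≡isOne∘dist : ∀ {q} (u v : Vertex q) → adj u v ≡ isOne (dist u v)
adj≡isOne∘dist u v with dist u v
... | 0           = refl
... | 1           = refl
... | suc (suc _) = refl

adj-cong-dist : ∀ {q} (u v u′ v′ : Vertex q) → dist u v ≡ dist u′ v′ → adj u v ≡ adj u′ v′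
adj-cong-dist u v u′ v′ d≡d′ =
  trans (adj≡isOne∘dist u v) (trans (cong isOne d≡d′) (sym (adj≡isOne∘dist u′ v′)))

adj⇒dist≡1 : ∀ {q} (u v : Vertex q) → adj u v ≡ true → dist u v ≡ 1
adj⇒dist≡1 u v u~v with dist u v | adj≡isOne∘dist u v
... | 1 | _ = refl
... | 0 | u~v≡false = ⊥-elim (true≢false (trans (sym u~v) u~v≡false))
... | suc (suc _) | u~v≡false = ⊥-elim (true≢false (trans (sym u~v) u~v≡false))

dist≡1⇒adj : ∀ {q} (u v : Vertex q) → dist u v ≡ 1 → adj u v ≡ true
dist≡1⇒adj u v d≡1 = trans (adj≡isOne∘dist u v) (cong isOne d≡1)

adj-along₂ : ∀ {q} {x y y′ z : Fin q} → y ≢ y′ → adj (x , y , z) (x , y′ , z) ≡ true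
adj-along₂ {x = x} {y} {y′} {z} y≢y′ = dist≡1⇒adj (x , y , z) (x , y′ , z) d≡1
  where
  d≡1 : dist (x , y , z) (x , y′ , z) ≡ 1
  d≡1 rewrite neq-refl x | neq-refl z | neq-≢ y≢y′ = refl

adj-across₃ : ∀ {q} {x y z a b c : Fin q} → adj (x , y , z) (a , b , c) ≡ true → z ≢ c →
              x ≡ a × y ≡ b
adj-across₃ {x = x} {y} {z} {a} {b} {c} u~v z≢c =
  neq≡0⇒≡ x a (m+n≡0⇒m≡0 _ rest≡0) , neq≡0⇒≡ y b (m+n≡0⇒n≡0 (neq x a) rest≡0)
  where
  rest≡0 : neq x a + neq y b ≡ 0
  rest≡0 = +-cancelʳ-≡ 1 _ 0
    (trans (cong (neq x a + neq y b +_) (sym (neq-≢ z≢c))) (adj⇒dist≡1 (x , y , z) (a , b , c) u~v))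

Isometry : ∀ {q} → (Vertex q → Vertex q) → Set
Isometry φ = ∀ u w → dist (φ u) (φ w) ≡ dist u w

ρ-isometry : ∀ {q} → Isometry {q} ρ
ρ-isometry (x , y , z) (x′ , y′ , z′) =
  trans (+-assoc (neq z z′) (neq x x′) (neq y y′)) (+-comm (neq z z′) _)

relabel₃-isometry : ∀ {q} (π : Permutation q q) → Isometry (relabel₃ π)
relabel₃-isometry π (x , y , z) (x′ , y′ , z′) = cong (neq x x′ + neq y y′ +_) (neq-permute π z z′)

nbrsIn-isometry : ∀ {q} (φ : Vertex q → Vertex q) → Isometry φ →
                  (∀ h → ΣV q (h ∘ φ) ≡ ΣV q h) →
                  ∀ P v → nbrsIn P (φ v) ≡ nbrsIn (P ∘ φ) v
nbrsIn-isometry {q} φ φ-iso φ-perm P v = begin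
  nbrsIn P (φ v)                                ≡⟨ φ-perm (λ w → bit (adj (φ v) w ∧ P w)) ⟨
  ΣV q (λ w → bit (adj (φ v) (φ w) ∧ P (φ w)))  ≡⟨ ΣV-cong q (λ w → cong (λ b → bit (b ∧ P (φ w)))
                                                                       (adj-cong-dist (φ v) (φ w) v w (φ-iso v w))) ⟩
  nbrsIn (P ∘ φ) v                              ∎
  where open ≡-Reasoning

nbrsIn-mono-< : ∀ {q} {P Q : VSet q} {v w : Vertex q} →
                (∀ u → adj v u ≡ true → P u ≡ true → Q u ≡ true) →
                adj v w ≡ true → P w ≡ false → Q w ≡ true → nbrsIn P v < nbrsIn Q v
nbrsIn-mono-< {q} {P} {Q} {v} {w} P⊆Q v~w w∉P w∈Q = ΣV-mono-< q pointwise w strict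
  where
  pointwise : ∀ u → bit (adj v u ∧ P u) ≤ bit (adj v u ∧ Q u)
  pointwise u with adj v u in v~u | P u in u∈P
  ... | false | _     = z≤n
  ... | true  | false = z≤n
  ... | true  | true  rewrite P⊆Q u v~u u∈P = s≤s z≤n
  strict : bit (adj v w ∧ P w) < bit (adj v w ∧ Q w)
  strict rewrite v~w | w∉P | w∈Q = s≤s z≤n

transpose-i≡j : ∀ {q} (i j : Fin q) → PC.transpose i j i ≡ j
transpose-i≡j i j rewrite dec-true (i ≟ i) refl = refl

transpose-j≡i : ∀ {q} {i j : Fin q} → i ≢ j → PC.transpose i j j ≡ i
transpose-j≡i {i = i} {j} i≢j rewrite dec-false (j ≟ i) (i≢j ∘ sym) | dec-true (j ≟ j) refl = refl

transpose-fixes : ∀ {q} {i j k : Fin q} → k ≢ i → k ≢ j → PC.transpose i j k ≡ k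
transpose-fixes {i = i} {j} {k} k≢i k≢j rewrite dec-false (k ≟ i) k≢i | dec-false (k ≟ j) k≢j = refl

erase : ∀ {q} → ASet q → Fin q → ASet q
erase X a c = X c ∧ not (does (c ≟ a))

erase-drops : ∀ {q} (X : ASet q) a → erase X a a ≡ false
erase-drops X a rewrite dec-true (a ≟ a) refl = ∧-zeroʳ (X a)

erase-keeps : ∀ {q} {X : ASet q} {a c} → X c ≡ true → c ≢ a → erase X a c ≡ true
erase-keeps {a = a} {c} Xc c≢a rewrite Xc | dec-false (c ≟ a) c≢a = refl

minimalBox₃-used : ∀ {q} {D : VSet q} {X Y Z : ASet q} {c} → MinimalBox D X Y Z → Z c ≡ true →
                   ¬ (∀ x y → (x , y , c) ∈ D → ⊥)
minimalBox₃-used {D = D} {X} {Y} {Z} {c} (box , minimal) Zc unused =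
  true≢false (trans (sym (proj₂ (proj₂ (minimal X Y (erase Z c) smaller)) c Zc)) (erase-drops Z c))
  where
  smaller : SubBox D X Y (erase Z c)
  smaller x y z xyz∈D with box x y z xyz∈D
  ... | Xx , Yy , Zz = Xx , Yy , erase-keeps {X = Z} Zz λ { refl → unused x y xyz∈D }

×-rotate : ∀ {A B C : Set} → A × B × C → B × C × A
×-rotate (a , b , c) = b , c , a

minimalBox-ρ : ∀ {q} {D : VSet q} {X Y Z : ASet q} → MinimalBox D X Y Z → MinimalBox (D ∘ ρ) Y Z X
minimalBox-ρ (box , minimal) =
  (λ x y z xyz∈Dρ → ×-rotate (box z x y xyz∈Dρ)) ,
  (λ Y₀ Z₀ X₀ box₀ → ×-rotate (minimal X₀ Y₀ Z₀ λ x y z xyz∈D → ×-rotate (×-rotate (box₀ y z x xyz∈D))))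

nonempty-ρ : ∀ {q} {D : VSet q} → Nonempty D → Nonempty (D ∘ ρ)
nonempty-ρ ((x , y , z) , xyz∈D) = (y , z , x) , xyz∈D

next : Fin 3 → Fin 3
next zero             = suc zero
next (suc zero)       = suc (suc zero)
next (suc (suc zero)) = zero

ρ-update : ∀ {q} i (a : Fin q) v → ρ (update i a v) ≡ update (next i) a (ρ v)
ρ-update zero             a (x , y , z) = refl
ρ-update (suc zero)       a (x , y , z) = refl
ρ-update (suc (suc zero)) a (x , y , z) = refl

unionOfMaxCliques-ρ : ∀ {q} i {D : VSet q} → UnionOfMaxCliques (next i) D → UnionOfMaxCliques i (D ∘ ρ)
unionOfMaxCliques-ρ i {D} cliques v ρv∈D a =
  subst (_∈ D) (sym (ρ-update i a v)) (cliques (ρ v) ρv∈D a)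

OuterRegular : ∀ {q} → VSet q → ℕ → Set
OuterRegular C β = ∀ v → v ∈ C → nbrsIn (λ w → not (C w)) v ≡ β

outerRegular-ρ : ∀ {q} {C : VSet q} {β} → OuterRegular C β → OuterRegular (C ∘ ρ) β
outerRegular-ρ {C = C} regular v ρv∈C =
  trans (sym (nbrsIn-isometry ρ ρ-isometry (ΣV-ρ _) (λ w → not (C w)) v)) (regular (ρ v) ρv∈C)

record CliquePartition {q} (C A B D : VSet q) : Set where
  field
    cover       : ∀ v → v ∈ C → (v ∈ A) ⊎ (v ∈ B) ⊎ (v ∈ D)
    A⊆C         : ∀ v → v ∈ A → v ∈ C
    B⊆C         : ∀ v → v ∈ B → v ∈ C
    D⊆C         : ∀ v → v ∈ D → v ∈ C
    A-cliques   : UnionOfMaxCliques zero A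
    B-cliques   : UnionOfMaxCliques (suc zero) B
    D-cliques   : UnionOfMaxCliques (suc (suc zero)) D
    disjoint-AB : Disjoint A B
    disjoint-AD : Disjoint A D
    disjoint-BD : Disjoint B D

cliquePartition-ρ : ∀ {q} {C A B D : VSet q} → CliquePartition C A B D →
                    CliquePartition (C ∘ ρ) (B ∘ ρ) (D ∘ ρ) (A ∘ ρ)
cliquePartition-ρ P = record
  { cover       = λ v → [ inj₂ ∘ inj₂ , [ inj₁ , inj₂ ∘ inj₁ ]′ ]′ ∘ cover (ρ v)
  ; A⊆C         = B⊆C ∘ ρ
  ; B⊆C         = D⊆C ∘ ρ
  ; D⊆C         = A⊆C ∘ ρ
  ; A-cliques   = unionOfMaxCliques-ρ zero B-cliques
  ; B-cliques   = unionOfMaxCliques-ρ (suc zero) D-cliques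
  ; D-cliques   = unionOfMaxCliques-ρ (suc (suc zero)) A-cliques
  ; disjoint-AB = disjoint-BD ∘ ρ
  ; disjoint-AD = λ v v∈B v∈A → disjoint-AB (ρ v) v∈A v∈B
  ; disjoint-BD = λ v v∈D v∈A → disjoint-AD (ρ v) v∈A v∈D
  }
  where open CliquePartition P

module _ {q} {C A B D : VSet q} {β} (P : CliquePartition C A B D) (regular : OuterRegular C β) where
  open CliquePartition P

  layer⊈D : (z₀ : Fin q) → (∀ x y → (x , y , z₀) ∈ C → (x , y , z₀) ∈ D) →
            Nonempty A → Nonempty D → ⊥
  layer⊈D z₀ layer⊆D ((a , b , z₁) , abz₁∈A) ((x , y , _) , xy∈D) = <-irrefl refl β<β
    where
    z₀≢z₁ : z₀ ≢ z₁
    z₀≢z₁ refl = disjoint-AD _ abz₁∈A (layer⊆D a b (A⊆C _ abz₁∈A))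

    column⊆D : ∀ c → (x , y , c) ∈ D
    column⊆D = D-cliques _ xy∈D

    xbz₁∈A : (x , b , z₁) ∈ A
    xbz₁∈A = A-cliques _ abz₁∈A x

    y≢b : y ≢ b
    y≢b refl = disjoint-AD _ xbz₁∈A (column⊆D z₁)

    w∉C : C (x , b , z₀) ≡ false
    w∉C with C (x , b , z₀) in w∈C
    ... | false = refl
    ... | true  = ⊥-elim (disjoint-AD _ xbz₁∈A (D-cliques _ (layer⊆D x b w∈C) z₁))

    σ : Permutation q q
    σ = transpose z₀ z₁

    φ : Vertex q → Vertex q
    φ = relabel₃ σ

    φ-layer : ∀ s t → φ (s , t , z₀) ≡ (s , t , z₁)
    φ-layer s t = cong (λ c → s , t , c) (transpose-i≡j z₀ z₁)

    C-preserved : ∀ u → adj (x , y , z₀) u ≡ true → u ∈ C → φ u ∈ C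
    C-preserved (s , t , c) v₀~u u∈C with z₁ ≟ c
    ... | yes refl with adj-across₃ {x = x} {y} {z₀} {s} {t} {c} v₀~u z₀≢z₁
    ...   | refl , refl = subst (λ c → (x , y , c) ∈ C) (sym (transpose-j≡i z₀≢z₁)) (D⊆C _ (column⊆D z₀))
    C-preserved (s , t , c) v₀~u u∈C | no z₁≢c with z₀ ≟ c
    ... | yes refl = subst (_∈ C) (sym (φ-layer s t)) (D⊆C _ (D-cliques _ (layer⊆D s t u∈C) z₁))
    ... | no z₀≢c  = subst (λ c → (s , t , c) ∈ C) (sym (transpose-fixes (z₀≢c ∘ sym) (z₁≢c ∘ sym))) u∈C

    outer-reflected : ∀ u → adj (x , y , z₀) u ≡ true → not (C (φ u)) ≡ true → not (C u) ≡ true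
    outer-reflected u v₀~u with C u in u∈C
    ... | false = λ _ → refl
    ... | true rewrite C-preserved u v₀~u u∈C = λ ()

    β<β : β < β
    β<β = begin-strict
      β                                      ≡⟨ regular _ (D⊆C _ (column⊆D z₁)) ⟨
      nbrsIn (not ∘ C) (x , y , z₁)          ≡⟨ cong (nbrsIn (not ∘ C)) (φ-layer x y) ⟨
      nbrsIn (not ∘ C) (φ (x , y , z₀))      ≡⟨ nbrsIn-isometry φ (relabel₃-isometry σ) (ΣV-relabel₃ q σ) (not ∘ C) (x , y , z₀) ⟩
      nbrsIn (not ∘ C ∘ φ) (x , y , z₀)      <⟨ nbrsIn-mono-< {P = not ∘ C ∘ φ} {not ∘ C} {x , y , z₀} {x , b , z₀} outer-reflected
                                                   (adj-along₂ {x = x} {z = z₀} y≢b)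
                                                   (cong not (subst (_∈ C) (sym (φ-layer x b)) (A⊆C _ xbz₁∈A)))
                                                   (cong not w∉C) ⟩
      nbrsIn (not ∘ C) (x , y , z₀)          ≡⟨ regular _ (D⊆C _ (column⊆D z₀)) ⟩
      β                                      ∎
      where open ≤-Reasoning

  minimalBoxes₃-differ : ∀ {X Y Z X′ Y′ Z′ : ASet q} → Nonempty A → Nonempty D →
                         MinimalBox A X Y Z → MinimalBox B X′ Y′ Z′ → ∀ c → Z′ c ≢ Z c
  minimalBoxes₃-differ {Z = Z} A≠∅ D≠∅ boxA boxB c Z′c≡Zc with Z c in Zc
  ... | true  = minimalBox₃-used boxA Zc λ x y xyc∈A → minimalBox₃-used boxB Z′c≡Zc λ x′ y′ x′y′c∈B →
                  disjoint-AB _ (A-cliques _ xyc∈A x′) (B-cliques _ x′y′c∈B y)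
  ... | false = layer⊈D c layer⊆D A≠∅ D≠∅
    where
    layer⊆D : ∀ x y → (x , y , c) ∈ C → (x , y , c) ∈ D
    layer⊆D x y xyc∈C with cover _ xyc∈C
    ... | inj₁ xyc∈A        = ⊥-elim (true≢false (trans (sym (proj₂ (proj₂ (proj₁ boxA x y c xyc∈A)))) Zc))
    ... | inj₂ (inj₁ xyc∈B) = ⊥-elim (true≢false (trans (sym (proj₂ (proj₂ (proj₁ boxB x y c xyc∈B)))) Z′c≡Zc))
    ... | inj₂ (inj₂ xyc∈D) = xyc∈D

lemma2 : (q : ℕ) → 2 ≤ q → (C C¹ C² C³ : VSet q) →
    CompletelyRegular1 C →
    (∀ v → C v ≡ (C¹ v ∨ C² v ∨ C³ v)) →
    Nonempty C¹ → Nonempty C² → Nonempty C³ →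
    UnionOfMaxCliques zero C¹ → UnionOfMaxCliques (suc zero) C² →
    UnionOfMaxCliques (suc (suc zero)) C³ →
    Disjoint C¹ C² → Disjoint C¹ C³ → Disjoint C² C³ →
    (S T R T′ R′ S′ : ASet q) →
    MinimalBox C¹ (λ _ → true) S T →
    MinimalBox C² R (λ _ → true) T′ →
    MinimalBox C³ R′ S′ (λ _ → true) →
    (∀ a → R′ a ≡ not (R a)) × (∀ a → T′ a ≡ not (T a)) × (∀ a → S′ a ≡ not (S a))
lemma2 q _ C C¹ C² C³ (_ , _ , _ , _ , _ , _ , regular , _) C≡∪ C¹≠∅ C²≠∅ C³≠∅
       cliques¹ cliques² cliques³ disjoint¹² disjoint¹³ disjoint²³ S T R T′ R′ S′ box¹ box² box³ =
  (λ a → ¬-not (minimalBoxes₃-differ P′ (outerRegular-ρ regular) (nonempty-ρ C²≠∅) (nonempty-ρ C¹≠∅)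
                  (minimalBox-ρ box²) (minimalBox-ρ box³) a)) ,
  (λ a → ¬-not (minimalBoxes₃-differ P regular C¹≠∅ C³≠∅ box¹ box² a)) ,
  (λ a → ¬-not (minimalBoxes₃-differ P″ (outerRegular-ρ (outerRegular-ρ regular))
                  (nonempty-ρ (nonempty-ρ C³≠∅)) (nonempty-ρ (nonempty-ρ C²≠∅))
                  (minimalBox-ρ (minimalBox-ρ box³)) (minimalBox-ρ (minimalBox-ρ box¹)) a ∘ sym))
  where
  P : CliquePartition C C¹ C² C³
  P = record
    { cover       = λ v v∈C → ∨-⊎ (C¹ v) (C² v) (C³ v) (trans (sym (C≡∪ v)) v∈C)
    ; A⊆C         = λ v v∈C¹ → trans (C≡∪ v) (cong (_∨ _) v∈C¹)
    ; B⊆C         = λ v v∈C² → trans (C≡∪ v) (trans (cong (λ b → C¹ v ∨ b ∨ C³ v) v∈C²) (∨-zeroʳ (C¹ v)))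
    ; D⊆C         = λ v v∈C³ → trans (C≡∪ v) (trans (cong (λ b → C¹ v ∨ C² v ∨ b) v∈C³)
                                                     (trans (cong (C¹ v ∨_) (∨-zeroʳ (C² v))) (∨-zeroʳ (C¹ v))))
    ; A-cliques   = cliques¹
    ; B-cliques   = cliques²
    ; D-cliques   = cliques³
    ; disjoint-AB = disjoint¹²
    ; disjoint-AD = disjoint¹³
    ; disjoint-BD = disjoint²³
    }
    where
    ∨-⊎ : ∀ a b c → (a ∨ b ∨ c) ≡ true → (a ≡ true) ⊎ (b ≡ true) ⊎ (c ≡ true)
    ∨-⊎ true  _     _ _    = inj₁ refl
    ∨-⊎ false true  _ _    = inj₂ (inj₁ refl)
    ∨-⊎ false false _ c≡t = inj₂ (inj₂ c≡t)
  P′ = cliquePartition-ρ P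
  P″ = cliquePartition-ρ P′
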